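{- Let $C\subset\mathbb{Z}_2^n$ be a $6$-cap. Then $\dim(C)\in\{4,5\}$. If $\dim(C)=5$, then $C$ is affinely independent. If $\dim(C)=4$, then: (a) $C$ is complete in dimension $4$, i.e. no point of the $4$-flat $\mathrm{aff}(C)$ outside $C$ can be added to $C$ to form a cap; (b) $C$ is a maximal cap in dimension $4$; (c) every point of $\mathrm{exc}(C)$ has multiplicity $2$.
   Context: $\mathbb{Z}_2^n$ is the $n$-dimensional vector space over $\mathbb{Z}_2$. A quad is a set of four distinct elements $a,b,c,d$ with $a+b+c+d=\vec 0$; a cap is a subset containing no quad; a $k$-cap is a cap with $k$ elements. For $S\subset\mathbb{Z}_2^n$, $\mathrm{exc}(S)=\{a+b+c: a,b,c\in S\text{ distinct}\}$; the multiplicity of $p\in\mathrm{exc}(S)$ is the number of $3$-element subsets $\{x,y,z\}\subset S$ with $x+y+z=p$. Over $\mathbb{Z}_2$, affine combinations are sums of an odd number of elements; $\mathrm{aff}(S)$ is the set of affine combinations of elements of $S$; $S$ is affinely independent if no element is an affine combination of the others. The dimension $\dim(C)$ of a cap is the dimension of the flat $\mathrm{aff}(C)$. A cap in dimension $r$ is maximal if it is complete in its $r$-flat and has the largest size among caps contained in an $r$-flat. -}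

module Defs where

open import Data.Nat using (ℕ; zero; suc; _%_; _≤_)
open import Data.Bool using (Bool; true; false; _xor_; if_then_else_; _∧_)
open import Data.Fin using (Fin; zero; suc; _≟_)
open import Data.Fin.Subset using (Subset; ∣_∣; inside; outside; _∈_)
open import Data.Vec using (Vec; []; _∷_; zipWith; replicate; lookup)
import Data.Vec.Functional as F
open import Data.List using (List; []; _∷_; map; _++_; length; filter)
open import Data.Product using (Σ; ∃; _×_; _,_)
open import Data.Sum using (_⊎_)
open import Data.Empty using (⊥)
open import Relation.Nullary using (¬_; Dec; yes; no)
open import Relation.Nullary.Decidable using (_×-dec_)
open import Relation.Binary.PropositionalEquality using (_≡_; _≢_)
open import Function using (_∘_; _↔_)
open import Function.Definitions using (Injective)
import Data.Vec.Properties as VP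
import Data.Bool.Properties as BP
import Data.Nat as N

V : ℕ → Set
V n = Vec Bool n

𝟎 : ∀ {n} → V n
𝟎 = replicate _ false

_⊕_ : ∀ {n} → V n → V n → V n
_⊕_ = zipWith _xor_

infixl 6 _⊕_

_≟V_ : ∀ {n} (x y : V n) → Dec (x ≡ y)
_≟V_ = VP.≡-dec BP._≟_

Family : ℕ → ℕ → Set
Family k n = Fin k → V n

sumSel : ∀ {k n} → Family k n → Subset k → V n
sumSel {zero}  p []      = 𝟎
sumSel {suc k} p (b ∷ s) = (if b then p zero else 𝟎) ⊕ sumSel (p ∘ suc) s

OddSize : ∀ {k} → Subset k → Set
OddSize s = ∣ s ∣ % 2 ≡ 1

-- x ∈ aff(p): x is a sum of an odd number of (distinct) points of the family
InAff : ∀ {k n} → Family k n → V n → Set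
InAff p x = ∃ λ (s : Subset _) → OddSize s × sumSel p s ≡ x

AffInd : ∀ {k n} → Family k n → Set
AffInd {k} p = ∀ (i : Fin k) (s : Subset k) →
  lookup s i ≡ outside → OddSize s → sumSel p s ≢ p i

-- dim(aff p) = d : aff p is spanned by an affine basis of d+1 points
Dim : ∀ {k n} → Family k n → ℕ → Set
Dim {n = n} p d = ∃ λ (b : Family (suc d) n) →
  AffInd b × (∀ x → (InAff p x → InAff b x) × (InAff b x → InAff p x))

NoQuad : ∀ {k n} → Family k n → Set
NoQuad {k} p = ∀ (a b c d : Fin k) →
  a ≢ b → a ≢ c → a ≢ d → b ≢ c → b ≢ d → c ≢ d →
  p a ⊕ p b ⊕ p c ⊕ p d ≢ 𝟎

IsCap : ∀ {k n} → Family k n → Set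
IsCap p = Injective _≡_ _≡_ p × NoQuad p

InFam : ∀ {k n} → Family k n → V n → Set
InFam p x = ∃ λ i → p i ≡ x

-- the family lies in some r-flat of ℤ₂ⁿ (aff of r+1 affinely independent points)
InFlat : ∀ {k n} → ℕ → Family k n → Set
InFlat {n = n} r p = ∃ λ (b : Family (suc r) n) → AffInd b × (∀ i → InAff b (p i))

CompleteInFlat : ∀ {k n} → Family k n → Set
CompleteInFlat p = ∀ x → InAff p x → ¬ InFam p x → ¬ NoQuad (x F.∷ p)

LargestInDim : ∀ {k n} → ℕ → Family k n → Set
LargestInDim {k} {n} r p =
  ∀ (m : ℕ) (D : Family m n) → IsCap D → InFlat r D → m N.≤ k

MaximalCap : ∀ {k n} → ℕ → Family k n → Set
MaximalCap r p = CompleteInFlat p × LargestInDim r p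

allSubsets : ∀ k → List (Subset k)
allSubsets zero    = [] ∷ []
allSubsets (suc k) = map (inside ∷_) (allSubsets k) ++ map (outside ∷_) (allSubsets k)

InExc : ∀ {k n} → Family k n → V n → Set
InExc p x = ∃ λ (s : Subset _) → ∣ s ∣ ≡ 3 × sumSel p s ≡ x

multiplicity : ∀ {k n} → Family k n → V n → ℕ
multiplicity {k} p x =
  length (filter (λ s → (∣ s ∣ N.≟ 3) ×-dec (sumSel p s ≟V x)) (allSubsets k))

-- A nontrivial affine relation among points of a cap has at least six terms: two terms would
-- be a repeated point and four terms a quad.  Hence a 6-cap C either is affinely independent
-- (dimension 5) or satisfies exactly one relation, ΣC = 0, and then any five of its points
-- form an affine basis (dimension 4); here one uses that m + 1 points in the hull of m points
-- always satisfy a relation, by pigeonhole on subsets.  In dimension 4 an odd subset of C and its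
-- complement have the same sum, so every point of aff C is a sum of one or three points of C:
-- one means it lies in C, three give a quad (completeness); two triples with the same sum
-- differ by a relation, so they are complementary (multiplicity 2); and a cap with seven points
-- in a 4-flat would contain two 6-subcaps with zero sum differing in a single point (maximality).

module Submission where

open import Defs
open import Data.Nat using (ℕ; zero; suc; _+_; _∸_; _^_; _≤_; _<_; _%_; s≤s; z≤n; _≤?_)
import Data.Nat.Properties as ℕ
open import Data.Bool using (Bool; true; false; not; _xor_; if_then_else_)
open import Data.Bool.Properties
  using (not-¬; xor-assoc; xor-comm; xor-same; xor-identityˡ; xor-identityʳ; true-xor; not-distribˡ-xor; not-distribʳ-xor; xor-annihilates-not)
open import Data.Fin using (Fin; zero; suc; punchIn; inject≤)
import Data.Fin.Properties as Fin
open import Data.Fin.Subset using (Subset; ∣_∣; ⁅_⁆; ⊤; ∁; Nonempty; inside; outside)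
open import Data.Fin.Subset.Properties using (x∈⁅x⁆; ∣⊥∣≡0; p⊂q⇒∣p∣<∣q∣; ⊥⊆; ∉⊥; ∣⊤∣≡n; ∣p∣≡n⇒p≡⊤; ∣p∣≤n; ∣⁅x⁆∣≡1; Empty-unique; nonempty?; ∣∁p∣≡n∸∣p∣)
open import Data.Vec using ([]; _∷_; here; there; head; lookup)
import Data.Vec.Properties as Vec
import Data.Vec.Functional as F
open import Data.List using (List; []; _∷_; length; filter; foldr)
import Data.List as List
import Data.List.Properties as List
open import Data.List.Relation.Unary.Unique.Propositional using (Unique)
import Data.List.Relation.Unary.Unique.Propositional.Properties as Unique
open import Data.List.Relation.Unary.AllPairs using ([]; _∷_)
open import Data.List.Relation.Unary.All as All using ([]; _∷_)
import Data.List.Relation.Unary.All.Properties as All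
open import Data.Product using (∃; ∃₂; _×_; _,_; proj₁; proj₂)
open import Data.Sum using (_⊎_; inj₁; inj₂)
open import Data.Empty using (⊥; ⊥-elim)
open import Relation.Unary using (_≐_; Decidable)
open import Relation.Binary.Definitions using (DecidableEquality)
open import Data.List.Relation.Binary.Disjoint.Propositional using (Disjoint)
open import Data.List.Membership.Propositional using () renaming (_∈_ to _∈ₗ_)
open import Data.List.Membership.Propositional.Properties using (∈-map⁺; ∈-map⁻; ∈-++⁺ˡ; ∈-++⁺ʳ)
open import Data.List.Relation.Unary.Any using (here; there)
open import Relation.Nullary using (¬_; yes; no; contradiction)
open import Relation.Nullary.Decidable using (_⊎-dec_; _×-dec_)
open import Relation.Binary.PropositionalEquality using (_≡_; _≢_; refl; sym; trans; cong; cong₂; subst; module ≡-Reasoning)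
open import Function using (_∘_; id)
open import Function.Definitions using (Injective)
open import Function.Bundles using (Inverse; Injection; _↔_; mk↔ₛ′)
open import Function.Properties.Inverse using (↔-trans; ↔-sym; ↔⇒↣)
open import Data.Product.Function.NonDependent.Propositional using (_×-↔_)

private variable k m n : ℕ

⊕-assoc : (x y z : V n) → (x ⊕ y) ⊕ z ≡ x ⊕ (y ⊕ z)
⊕-assoc = Vec.zipWith-assoc xor-assoc

⊕-comm : (x y : V n) → x ⊕ y ≡ y ⊕ x
⊕-comm = Vec.zipWith-comm xor-comm

⊕-identityˡ : (x : V n) → 𝟎 ⊕ x ≡ x
⊕-identityˡ = Vec.zipWith-identityˡ xor-identityˡ

⊕-identityʳ : (x : V n) → x ⊕ 𝟎 ≡ x
⊕-identityʳ = Vec.zipWith-identityʳ xor-identityʳ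

⊕-self : (x : V n) → x ⊕ x ≡ 𝟎
⊕-self []      = refl
⊕-self (b ∷ x) = cong₂ _∷_ (xor-same b) (⊕-self x)

⊕-cancelˡ : (a x : V n) → a ⊕ (a ⊕ x) ≡ x
⊕-cancelˡ a x = begin
  a ⊕ (a ⊕ x) ≡⟨ ⊕-assoc a a x ⟨
  (a ⊕ a) ⊕ x ≡⟨ cong (_⊕ x) (⊕-self a) ⟩
  𝟎 ⊕ x       ≡⟨ ⊕-identityˡ x ⟩
  x           ∎
  where open ≡-Reasoning

⊕≡𝟎⇒≡ : {x y : V n} → x ⊕ y ≡ 𝟎 → x ≡ y
⊕≡𝟎⇒≡ {x = x} {y} e = begin
  x                 ≡⟨ ⊕-identityʳ x ⟨
  x ⊕ 𝟎             ≡⟨ cong (x ⊕_) e ⟨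
  x ⊕ (x ⊕ y)       ≡⟨ ⊕-cancelˡ x y ⟩
  y                 ∎
  where open ≡-Reasoning

≡⇒⊕≡𝟎 : {x y : V n} → x ≡ y → x ⊕ y ≡ 𝟎
≡⇒⊕≡𝟎 {x = x} refl = ⊕-self x

⊕-interchange : (a b c d : V n) → (a ⊕ b) ⊕ (c ⊕ d) ≡ (a ⊕ c) ⊕ (b ⊕ d)
⊕-interchange a b c d = begin
  (a ⊕ b) ⊕ (c ⊕ d) ≡⟨ ⊕-assoc a b (c ⊕ d) ⟩
  a ⊕ (b ⊕ (c ⊕ d)) ≡⟨ cong (a ⊕_) (⊕-assoc b c d) ⟨
  a ⊕ ((b ⊕ c) ⊕ d) ≡⟨ cong (λ w → a ⊕ (w ⊕ d)) (⊕-comm b c) ⟩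
  a ⊕ ((c ⊕ b) ⊕ d) ≡⟨ cong (a ⊕_) (⊕-assoc c b d) ⟩
  a ⊕ (c ⊕ (b ⊕ d)) ≡⟨ ⊕-assoc a c (b ⊕ d) ⟨
  (a ⊕ c) ⊕ (b ⊕ d) ∎
  where open ≡-Reasoning

-- A Boolean parity, additive under ⊕ (odd-∣⊕∣); OddSize is its _%_ 2 form.
odd : ℕ → Bool
odd zero          = false
odd (suc zero)    = true
odd (suc (suc n)) = odd n

odd-suc : ∀ n → odd (suc n) ≡ not (odd n)
odd-suc zero          = refl
odd-suc (suc zero)    = refl
odd-suc (suc (suc n)) = odd-suc n

odd⇒OddSize : (s : Subset k) → odd ∣ s ∣ ≡ true → OddSize s
odd⇒OddSize s = odd⇒%2≡1 ∣ s ∣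
  where
  odd⇒%2≡1 : ∀ m → odd m ≡ true → m % 2 ≡ 1
  odd⇒%2≡1 (suc zero)    _ = refl
  odd⇒%2≡1 (suc (suc m)) e = odd⇒%2≡1 m e

OddSize⇒odd : (s : Subset k) → OddSize s → odd ∣ s ∣ ≡ true
OddSize⇒odd s = %2≡1⇒odd ∣ s ∣
  where
  %2≡1⇒odd : ∀ m → m % 2 ≡ 1 → odd m ≡ true
  %2≡1⇒odd (suc zero)    _ = refl
  %2≡1⇒odd (suc (suc m)) e = %2≡1⇒odd m e

odd-∣⊕∣ : (s t : Subset k) → odd ∣ s ⊕ t ∣ ≡ odd ∣ s ∣ xor odd ∣ t ∣
odd-∣⊕∣ []          []          = refl
odd-∣⊕∣ (false ∷ s) (false ∷ t) = odd-∣⊕∣ s t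
odd-∣⊕∣ (false ∷ s) (true ∷ t) = begin
  odd (suc ∣ s ⊕ t ∣)               ≡⟨ odd-suc ∣ s ⊕ t ∣ ⟩
  not (odd ∣ s ⊕ t ∣)               ≡⟨ cong not (odd-∣⊕∣ s t) ⟩
  not (odd ∣ s ∣ xor odd ∣ t ∣)     ≡⟨ not-distribʳ-xor (odd ∣ s ∣) (odd ∣ t ∣) ⟩
  odd ∣ s ∣ xor not (odd ∣ t ∣)     ≡⟨ cong (odd ∣ s ∣ xor_) (odd-suc ∣ t ∣) ⟨
  odd ∣ s ∣ xor odd (suc ∣ t ∣)     ∎
  where open ≡-Reasoning
odd-∣⊕∣ (true ∷ s) (false ∷ t) = begin
  odd (suc ∣ s ⊕ t ∣)               ≡⟨ odd-suc ∣ s ⊕ t ∣ ⟩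
  not (odd ∣ s ⊕ t ∣)               ≡⟨ cong not (odd-∣⊕∣ s t) ⟩
  not (odd ∣ s ∣ xor odd ∣ t ∣)     ≡⟨ not-distribˡ-xor (odd ∣ s ∣) (odd ∣ t ∣) ⟩
  not (odd ∣ s ∣) xor odd ∣ t ∣     ≡⟨ cong (_xor odd ∣ t ∣) (odd-suc ∣ s ∣) ⟨
  odd (suc ∣ s ∣) xor odd ∣ t ∣     ∎
  where open ≡-Reasoning
odd-∣⊕∣ (true ∷ s) (true ∷ t) = begin
  odd ∣ s ⊕ t ∣                           ≡⟨ odd-∣⊕∣ s t ⟩
  odd ∣ s ∣ xor odd ∣ t ∣                 ≡⟨ xor-annihilates-not (odd ∣ s ∣) (odd ∣ t ∣) ⟨
  not (odd ∣ s ∣) xor not (odd ∣ t ∣)     ≡⟨ cong₂ _xor_ (odd-suc ∣ s ∣) (odd-suc ∣ t ∣) ⟨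
  odd (suc ∣ s ∣) xor odd (suc ∣ t ∣)     ∎
  where open ≡-Reasoning

odd-∣⁅⁆∣ : (i : Fin k) → odd ∣ ⁅ i ⁆ ∣ ≡ true
odd-∣⁅⁆∣ i = cong odd (∣⁅x⁆∣≡1 i)

≢∁ : (s : Subset (suc k)) → s ≢ ∁ s
≢∁ (b ∷ s) e = not-¬ refl (cong head e)

⊕⊤≡∁ : (s : Subset k) → s ⊕ ⊤ ≡ ∁ s
⊕⊤≡∁ []      = refl
⊕⊤≡∁ (b ∷ s) = cong₂ _∷_ (trans (xor-comm b true) (true-xor b)) (⊕⊤≡∁ s)

odd-∣∁∣ : (s : Subset k) → odd ∣ ∁ s ∣ ≡ odd ∣ s ∣ xor odd k
odd-∣∁∣ {k} s = begin
  odd ∣ ∁ s ∣                  ≡⟨ cong (odd ∘ ∣_∣) (⊕⊤≡∁ s) ⟨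
  odd ∣ s ⊕ ⊤ ∣                ≡⟨ odd-∣⊕∣ s ⊤ ⟩
  odd ∣ s ∣ xor odd ∣ ⊤ {k} ∣  ≡⟨ cong (λ m → odd ∣ s ∣ xor odd m) (∣⊤∣≡n k) ⟩
  odd ∣ s ∣ xor odd k          ∎
  where open ≡-Reasoning

odd-∣𝟎∣ : odd ∣ 𝟎 {k} ∣ ≡ false
odd-∣𝟎∣ {zero}  = refl
odd-∣𝟎∣ {suc k} = odd-∣𝟎∣ {k}

sumSel-⊕ : (p : Family k n) (s t : Subset k) → sumSel p (s ⊕ t) ≡ sumSel p s ⊕ sumSel p t
sumSel-⊕ p []      []      = sym (⊕-self 𝟎)
sumSel-⊕ p (a ∷ s) (b ∷ t) = begin
  pick (a xor b) ⊕ sumSel (p ∘ suc) (s ⊕ t)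
    ≡⟨ cong₂ _⊕_ (pick-xor a b) (sumSel-⊕ (p ∘ suc) s t) ⟩
  (pick a ⊕ pick b) ⊕ (sumSel (p ∘ suc) s ⊕ sumSel (p ∘ suc) t)
    ≡⟨ ⊕-interchange (pick a) (pick b) _ _ ⟩
  (pick a ⊕ sumSel (p ∘ suc) s) ⊕ (pick b ⊕ sumSel (p ∘ suc) t) ∎
  where
  open ≡-Reasoning
  pick : Bool → V _
  pick b = if b then p zero else 𝟎
  pick-xor : ∀ a b → pick (a xor b) ≡ pick a ⊕ pick b
  pick-xor false b     = sym (⊕-identityˡ (pick b))
  pick-xor true  false = sym (⊕-identityʳ (p zero))
  pick-xor true  true  = sym (⊕-self (p zero))

sumSel-𝟎 : (p : Family k n) → sumSel p 𝟎 ≡ 𝟎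
sumSel-𝟎 {zero}  p = refl
sumSel-𝟎 {suc k} p = trans (⊕-identityˡ _) (sumSel-𝟎 (p ∘ suc))

sumSel-⁅⁆ : (p : Family k n) (i : Fin k) → sumSel p ⁅ i ⁆ ≡ p i
sumSel-⁅⁆ p zero    = trans (cong (p zero ⊕_) (sumSel-𝟎 (p ∘ suc))) (⊕-identityʳ (p zero))
sumSel-⁅⁆ p (suc i) = trans (⊕-identityˡ _) (sumSel-⁅⁆ (p ∘ suc) i)

sumSel-∁ : (p : Family k n) (s : Subset k) → sumSel p (∁ s) ≡ sumSel p s ⊕ sumSel p ⊤
sumSel-∁ p s = trans (cong (sumSel p) (sym (⊕⊤≡∁ s))) (sumSel-⊕ p s ⊤)

sumSel-compose : (c : Family k m) (g : Family m n) (f : Family k n) →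
  (∀ j → sumSel g (c j) ≡ f j) → (T : Subset k) → sumSel f T ≡ sumSel g (sumSel c T)
sumSel-compose c g f h []      = sym (sumSel-𝟎 g)
sumSel-compose c g f h (b ∷ T) = begin
  pickf b ⊕ sumSel (f ∘ suc) T
    ≡⟨ cong₂ _⊕_ (pick-compose b) (sumSel-compose (c ∘ suc) g (f ∘ suc) (h ∘ suc) T) ⟩
  sumSel g (pickc b) ⊕ sumSel g (sumSel (c ∘ suc) T)
    ≡⟨ sumSel-⊕ g (pickc b) _ ⟨
  sumSel g (pickc b ⊕ sumSel (c ∘ suc) T) ∎
  where
  open ≡-Reasoning
  pickf : Bool → V _
  pickf b = if b then f zero else 𝟎
  pickc : Bool → Subset _
  pickc b = if b then c zero else 𝟎
  pick-compose : ∀ b → pickf b ≡ sumSel g (pickc b)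
  pick-compose true  = sym (h zero)
  pick-compose false = sym (sumSel-𝟎 g)

odd-∣sumSel∣ : (c : Family k m) → (∀ j → odd ∣ c j ∣ ≡ true) →
  (T : Subset k) → odd ∣ sumSel c T ∣ ≡ odd ∣ T ∣
odd-∣sumSel∣ {m = m} c oc []        = odd-∣𝟎∣ {m}
odd-∣sumSel∣ {m = m} c oc (false ∷ T) = begin
  odd ∣ 𝟎 ⊕ sumSel (c ∘ suc) T ∣                     ≡⟨ odd-∣⊕∣ 𝟎 (sumSel (c ∘ suc) T) ⟩
  odd ∣ 𝟎 {m} ∣ xor odd ∣ sumSel (c ∘ suc) T ∣       ≡⟨ cong₂ _xor_ (odd-∣𝟎∣ {m}) (odd-∣sumSel∣ (c ∘ suc) (oc ∘ suc) T) ⟩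
  odd ∣ T ∣                                          ∎
  where open ≡-Reasoning
odd-∣sumSel∣ c oc (true ∷ T) = begin
  odd ∣ c zero ⊕ sumSel (c ∘ suc) T ∣                ≡⟨ odd-∣⊕∣ (c zero) (sumSel (c ∘ suc) T) ⟩
  odd ∣ c zero ∣ xor odd ∣ sumSel (c ∘ suc) T ∣      ≡⟨ cong₂ _xor_ (oc zero) (odd-∣sumSel∣ (c ∘ suc) (oc ∘ suc) T) ⟩
  true xor odd ∣ T ∣                                 ≡⟨ true-xor (odd ∣ T ∣) ⟩
  not (odd ∣ T ∣)                                    ≡⟨ odd-suc ∣ T ∣ ⟨
  odd (suc ∣ T ∣)                                    ∎
  where open ≡-Reasoning

elements : Subset k → List (Fin k)
elements []          = []
elements (true ∷ s)  = zero ∷ List.map suc (elements s)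
elements (false ∷ s) = List.map suc (elements s)

length-elements : (s : Subset k) → length (elements s) ≡ ∣ s ∣
length-elements []          = refl
length-elements (true ∷ s)  = cong suc (trans (List.length-map suc (elements s)) (length-elements s))
length-elements (false ∷ s) = trans (List.length-map suc (elements s)) (length-elements s)

elements-unique : (s : Subset k) → Unique (elements s)
elements-unique []          = []
elements-unique (true ∷ s)  =
  All.map⁺ (All.universal (λ _ ()) (elements s)) ∷ Unique.map⁺ Fin.suc-injective (elements-unique s)
elements-unique (false ∷ s) = Unique.map⁺ Fin.suc-injective (elements-unique s)

sumSel-elements : (p : Family k n) (s : Subset k) → sumSel p s ≡ foldr _⊕_ 𝟎 (List.map p (elements s))
sumSel-elements p []          = refl
sumSel-elements p (true ∷ s)  =
  cong (p zero ⊕_) (trans (sumSel-elements (p ∘ suc) s) (cong (foldr _⊕_ 𝟎) (List.map-∘ (elements s))))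
sumSel-elements p (false ∷ s) =
  trans (⊕-identityˡ _) (trans (sumSel-elements (p ∘ suc) s) (cong (foldr _⊕_ 𝟎) (List.map-∘ (elements s))))

Subset↔Fin : ∀ k → Subset k ↔ Fin (2 ^ k)
Subset↔Fin zero    = mk↔ₛ′ (λ _ → zero) (λ _ → []) (λ { zero → refl }) (λ { [] → refl })
Subset↔Fin (suc k) = ↔-trans ∷↔× (↔-trans (↔-sym Fin.2↔Bool ×-↔ Subset↔Fin k) (↔-sym Fin.*↔×))
  where
  ∷↔× : Subset (suc k) ↔ (Bool × Subset k)
  ∷↔× = mk↔ₛ′ (λ { (b ∷ s) → b , s }) (λ (b , s) → b ∷ s) (λ _ → refl) (λ { (b ∷ s) → refl })

↔-pigeonhole : {A B : Set} {a b : ℕ} → A ↔ Fin a → B ↔ Fin b → b < a →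
  (H : A → B) → ∃₂ λ x y → x ≢ y × H x ≡ H y
↔-pigeonhole A↔ B↔ b<a H
  with i , j , i<j , e ← Fin.pigeonhole b<a (Inverse.to B↔ ∘ H ∘ Inverse.from A↔)
  = Inverse.from A↔ i , Inverse.from A↔ j , Fin.<⇒≢ i<j ∘ Injection.injective (↔⇒↣ (↔-sym A↔))
  , Injection.injective (↔⇒↣ B↔) e

subset-pigeonhole : (H : Subset (suc k) → Subset k) → ∃₂ λ s t → s ≢ t × H s ≡ H t
subset-pigeonhole {k} = ↔-pigeonhole (Subset↔Fin (suc k)) (Subset↔Fin k) (ℕ.^-monoʳ-< 2 (s≤s (s≤s z≤n)) (ℕ.n<1+n k))

record AffineRelation (p : Family k n) (T : Subset k) : Set where
  constructor affineRelation
  field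
    nonempty  : Nonempty T
    even      : odd ∣ T ∣ ≡ false
    sum≡𝟎     : sumSel p T ≡ 𝟎

AffinelyDependent : Family k n → Set
AffinelyDependent p = ∃ (AffineRelation p)

lookup-⊕⁅⁆ : (s : Subset k) (i : Fin k) → lookup (s ⊕ ⁅ i ⁆) i ≡ not (lookup s i)
lookup-⊕⁅⁆ s i = begin
  lookup (s ⊕ ⁅ i ⁆) i              ≡⟨ Vec.lookup-zipWith _xor_ i s ⁅ i ⁆ ⟩
  lookup s i xor lookup ⁅ i ⁆ i     ≡⟨ cong (lookup s i xor_) (Vec.[]=⇒lookup (x∈⁅x⁆ i)) ⟩
  lookup s i xor true               ≡⟨ xor-comm (lookup s i) true ⟩
  not (lookup s i)                  ∎
  where open ≡-Reasoning

¬AffInd⇒relation : (p : Family k n) (i : Fin k) (s : Subset k) →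
  lookup s i ≡ outside → OddSize s → sumSel p s ≡ p i → AffineRelation p (s ⊕ ⁅ i ⁆)
¬AffInd⇒relation p i s i∉s odd-s e = affineRelation
  (i , Vec.lookup⇒[]= i _ (trans (lookup-⊕⁅⁆ s i) (cong not i∉s)))
  (trans (odd-∣⊕∣ s ⁅ i ⁆) (cong₂ _xor_ (OddSize⇒odd s odd-s) (odd-∣⁅⁆∣ i)))
  (trans (sumSel-⊕ p s ⁅ i ⁆) (≡⇒⊕≡𝟎 (trans e (sym (sumSel-⁅⁆ p i)))))

AffInd⇒¬relation : {p : Family k n} {T : Subset k} → AffInd p → ¬ AffineRelation p T
AffInd⇒¬relation {p = p} {T} ind (affineRelation (i , i∈T) even T≡𝟎) =
  ind i (T ⊕ ⁅ i ⁆) i∉T⊕i (odd⇒OddSize (T ⊕ ⁅ i ⁆) odd-T⊕i) sum-T⊕i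
  where
  open ≡-Reasoning
  i∉T⊕i : lookup (T ⊕ ⁅ i ⁆) i ≡ outside
  i∉T⊕i = trans (lookup-⊕⁅⁆ T i) (cong not (Vec.[]=⇒lookup i∈T))
  odd-T⊕i : odd ∣ T ⊕ ⁅ i ⁆ ∣ ≡ true
  odd-T⊕i = trans (odd-∣⊕∣ T ⁅ i ⁆) (cong₂ _xor_ even (odd-∣⁅⁆∣ i))
  sum-T⊕i : sumSel p (T ⊕ ⁅ i ⁆) ≡ p i
  sum-T⊕i = begin
    sumSel p (T ⊕ ⁅ i ⁆)        ≡⟨ sumSel-⊕ p T ⁅ i ⁆ ⟩
    sumSel p T ⊕ sumSel p ⁅ i ⁆ ≡⟨ cong₂ _⊕_ T≡𝟎 (sumSel-⁅⁆ p i) ⟩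
    𝟎 ⊕ p i                     ≡⟨ ⊕-identityˡ (p i) ⟩
    p i                         ∎

≢𝟎⇒Nonempty : {T : Subset k} → T ≢ 𝟎 → Nonempty T
≢𝟎⇒Nonempty {T = T} T≢𝟎 with nonempty? T
... | yes ne = ne
... | no ¬ne = contradiction (Empty-unique ¬ne) T≢𝟎

Nonempty⇒∣∣≢0 : {T : Subset k} → Nonempty T → ∣ T ∣ ≢ 0
Nonempty⇒∣∣≢0 {k} {T} (i , i∈T) ∣T∣≡0 =
  ℕ.<-irrefl (trans (∣⊥∣≡0 k) (sym ∣T∣≡0)) (p⊂q⇒∣p∣<∣q∣ (⊥⊆ , i , i∈T , ∉⊥))

-- By pigeonhole, the map sending a subset T of the points f j to the sum of their coefficient
-- subsets over g collides; the symmetric difference of a colliding pair is the relation.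
hull-dependent : (f : Family (suc m) n) (g : Family m n) → (∀ j → InAff g (f j)) → AffinelyDependent f
hull-dependent {m} f g f⊆g
  with T₁ , T₂ , T₁≢T₂ , e ← subset-pigeonhole (sumSel (proj₁ ∘ f⊆g))
  = T₁ ⊕ T₂ , affineRelation (≢𝟎⇒Nonempty (T₁≢T₂ ∘ ⊕≡𝟎⇒≡)) even sum≡𝟎
  where
  c : Family (suc m) m
  c j = proj₁ (f⊆g j)
  c𝟎 : sumSel c (T₁ ⊕ T₂) ≡ 𝟎
  c𝟎 = trans (sumSel-⊕ c T₁ T₂) (≡⇒⊕≡𝟎 e)
  even : odd ∣ T₁ ⊕ T₂ ∣ ≡ false
  even = begin
    odd ∣ T₁ ⊕ T₂ ∣          ≡⟨ odd-∣sumSel∣ c (λ j → OddSize⇒odd (c j) (proj₁ (proj₂ (f⊆g j)))) (T₁ ⊕ T₂) ⟨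
    odd ∣ sumSel c (T₁ ⊕ T₂) ∣ ≡⟨ cong (odd ∘ ∣_∣) c𝟎 ⟩
    odd ∣ 𝟎 {m} ∣             ≡⟨ odd-∣𝟎∣ {m} ⟩
    false                     ∎
    where open ≡-Reasoning
  sum≡𝟎 : sumSel f (T₁ ⊕ T₂) ≡ 𝟎
  sum≡𝟎 = begin
    sumSel f (T₁ ⊕ T₂)          ≡⟨ sumSel-compose c g f (λ j → proj₂ (proj₂ (f⊆g j))) (T₁ ⊕ T₂) ⟩
    sumSel g (sumSel c (T₁ ⊕ T₂)) ≡⟨ cong (sumSel g) c𝟎 ⟩
    sumSel g 𝟎                  ≡⟨ sumSel-𝟎 g ⟩
    𝟎                           ∎
    where open ≡-Reasoning

even-cases : ∀ m → odd m ≡ false → m ≡ 0 ⊎ m ≡ 2 ⊎ m ≡ 4 ⊎ 6 ≤ m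
even-cases 0 _ = inj₁ refl
even-cases 2 _ = inj₂ (inj₁ refl)
even-cases 4 _ = inj₂ (inj₂ (inj₁ refl))
even-cases (suc (suc (suc (suc (suc (suc m)))))) _ = inj₂ (inj₂ (inj₂ (ℕ.m≤m+n 6 m)))

pair-sum≢𝟎 : {p : Family k n} → Injective _≡_ _≡_ p → (xs : List (Fin k)) → Unique xs →
  length xs ≡ 2 → foldr _⊕_ 𝟎 (List.map p xs) ≢ 𝟎
pair-sum≢𝟎 {p = p} inj (i ∷ j ∷ []) ((i≢j ∷ []) ∷ _) _ e =
  i≢j (inj (⊕≡𝟎⇒≡ (trans (cong (p i ⊕_) (sym (⊕-identityʳ (p j)))) e)))

quad-sum≢𝟎 : {p : Family k n} → NoQuad p → (xs : List (Fin k)) → Unique xs →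
  length xs ≡ 4 → foldr _⊕_ 𝟎 (List.map p xs) ≢ 𝟎
quad-sum≢𝟎 {p = p} nq (a ∷ b ∷ c ∷ d ∷ []) ((a≢b ∷ a≢c ∷ a≢d ∷ []) ∷ (b≢c ∷ b≢d ∷ []) ∷ (c≢d ∷ []) ∷ _) _ e =
  nq a b c d a≢b a≢c a≢d b≢c b≢d c≢d (begin
    p a ⊕ p b ⊕ p c ⊕ p d               ≡⟨ ⊕-assoc (p a ⊕ p b) (p c) (p d) ⟩
    p a ⊕ p b ⊕ (p c ⊕ p d)             ≡⟨ ⊕-assoc (p a) (p b) (p c ⊕ p d) ⟩
    p a ⊕ (p b ⊕ (p c ⊕ p d))           ≡⟨ cong (λ w → p a ⊕ (p b ⊕ (p c ⊕ w))) (⊕-identityʳ (p d)) ⟨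
    p a ⊕ (p b ⊕ (p c ⊕ (p d ⊕ 𝟎)))     ≡⟨ e ⟩
    𝟎                                   ∎)
  where open ≡-Reasoning

-- An affine relation with two terms is a repeated point, one with four terms is a quad.
cap-relation-size : {p : Family k n} {T : Subset k} → IsCap p → AffineRelation p T → 6 ≤ ∣ T ∣
cap-relation-size {p = p} {T} (inj , nq) (affineRelation ne even T≡𝟎) with even-cases ∣ T ∣ even
... | inj₁ ∣T∣≡0               = contradiction ∣T∣≡0 (Nonempty⇒∣∣≢0 ne)
... | inj₂ (inj₁ ∣T∣≡2)        = ⊥-elim (pair-sum≢𝟎 inj (elements T) (elements-unique T)
  (trans (length-elements T) ∣T∣≡2) (trans (sym (sumSel-elements p T)) T≡𝟎))
... | inj₂ (inj₂ (inj₁ ∣T∣≡4)) = ⊥-elim (quad-sum≢𝟎 nq (elements T) (elements-unique T)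
  (trans (length-elements T) ∣T∣≡4) (trans (sym (sumSel-elements p T)) T≡𝟎))
... | inj₂ (inj₂ (inj₂ 6≤∣T∣)) = 6≤∣T∣

relation-tail : {p : Family (suc k) n} {T : Subset k} → AffineRelation (p ∘ suc) T → AffineRelation p (false ∷ T)
relation-tail (affineRelation (i , i∈T) even T≡𝟎) =
  affineRelation (suc i , there i∈T) even (trans (⊕-identityˡ _) T≡𝟎)

IsCap-∘ : {D : Family m n} → IsCap D → (σ : Fin k → Fin m) → Injective _≡_ _≡_ σ → IsCap (D ∘ σ)
IsCap-∘ (inj , nq) σ σ-inj = σ-inj ∘ inj ,
  λ a b c d a≢b a≢c a≢d b≢c b≢d c≢d →
    nq (σ a) (σ b) (σ c) (σ d) (a≢b ∘ σ-inj) (a≢c ∘ σ-inj) (a≢d ∘ σ-inj) (b≢c ∘ σ-inj) (b≢d ∘ σ-inj) (c≢d ∘ σ-inj)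

∷-injective : {p : Family k n} {x : V n} → ¬ InFam p x → Injective _≡_ _≡_ p → Injective _≡_ _≡_ (x F.∷ p)
∷-injective x∉p inj {zero}  {zero}  _ = refl
∷-injective x∉p inj {zero}  {suc j} e = contradiction (j , sym e) x∉p
∷-injective x∉p inj {suc i} {zero}  e = contradiction (i , e) x∉p
∷-injective x∉p inj {suc i} {suc j} e = cong suc (inj e)

InAff-self : (p : Family k n) (j : Fin k) → InAff p (p j)
InAff-self p j = ⁅ j ⁆ , odd⇒OddSize ⁅ j ⁆ (odd-∣⁅⁆∣ j) , sumSel-⁅⁆ p j

∁-represents : (p : Family k n) → odd k ≡ false → sumSel p ⊤ ≡ 𝟎 →
  (s : Subset k) → OddSize s → OddSize (∁ s) × sumSel p (∁ s) ≡ sumSel p s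
∁-represents p even-k total s odd-s =
  odd⇒OddSize (∁ s) (trans (odd-∣∁∣ s) (cong₂ _xor_ (OddSize⇒odd s odd-s) even-k)) ,
  trans (sumSel-∁ p s) (trans (cong (sumSel p s ⊕_) total) (⊕-identityʳ (sumSel p s)))

InAff-tail⇒InAff : (p : Family (suc k) n) {x : V n} → InAff (p ∘ suc) x → InAff p x
InAff-tail⇒InAff p (s , odd-s , e) = false ∷ s , odd-s , trans (⊕-identityˡ _) e

InAff⇒InAff-tail : (p : Family (suc k) n) → odd (suc k) ≡ false → sumSel p ⊤ ≡ 𝟎 →
  {x : V n} → InAff p x → InAff (p ∘ suc) x
InAff⇒InAff-tail p even total (false ∷ s , odd-s , e) = s , odd-s , trans (sym (⊕-identityˡ _)) e
InAff⇒InAff-tail p even total (true ∷ s , odd-s , e) with ∁-represents p even total (true ∷ s) odd-s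
... | odd-∁s , same-sum = ∁ s , odd-∁s , trans (sym (⊕-identityˡ _)) (trans same-sum e)

module _ {A : Set} (_≟_ : DecidableEquality A) where

  length-filter-≟ : {a : A} {xs : List A} → Unique xs → a ∈ₗ xs → length (filter (_≟ a) xs) ≡ 1
  length-filter-≟ {xs = x ∷ xs} (x∉xs ∷ _) (here refl) = begin
    length (filter (_≟ x) (x ∷ xs)) ≡⟨ cong length (List.filter-accept (_≟ x) refl) ⟩
    suc (length (filter (_≟ x) xs)) ≡⟨ cong (suc ∘ length) (List.filter-none (_≟ x) (All.map (λ x≢y y≡x → x≢y (sym y≡x)) x∉xs)) ⟩
    1                               ∎
    where open ≡-Reasoning
  length-filter-≟ {xs = x ∷ xs} (x∉xs ∷ unique) (there a∈xs) =
    trans (cong length (List.filter-reject (_≟ _) (All.lookup x∉xs a∈xs))) (length-filter-≟ unique a∈xs)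

length-filter-⊎ : {A : Set} {P Q : A → Set} (P? : Decidable P) (Q? : Decidable Q) → (∀ {x} → P x → ¬ Q x) →
  (xs : List A) → length (filter (λ x → P? x ⊎-dec Q? x) xs) ≡ length (filter P? xs) + length (filter Q? xs)
length-filter-⊎ P? Q? disjoint [] = refl
length-filter-⊎ P? Q? disjoint (x ∷ xs) with P? x | Q? x
... | yes px | yes qx = contradiction qx (disjoint px)
... | yes _  | no  _  = cong suc (length-filter-⊎ P? Q? disjoint xs)
... | no  _  | yes _  = trans (cong suc (length-filter-⊎ P? Q? disjoint xs)) (sym (ℕ.+-suc _ _))
... | no  _  | no  _  = length-filter-⊎ P? Q? disjoint xs

allSubsets-unique : ∀ k → Unique (allSubsets k)
allSubsets-unique zero    = [] ∷ []
allSubsets-unique (suc k) = Unique.++⁺ (Unique.map⁺ Vec.∷-injectiveʳ (allSubsets-unique k))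
  (Unique.map⁺ Vec.∷-injectiveʳ (allSubsets-unique k)) disjoint
  where
  disjoint : Disjoint (List.map (inside ∷_) (allSubsets k)) (List.map (outside ∷_) (allSubsets k))
  disjoint (v∈ins , v∈outs) with ∈-map⁻ (inside ∷_) v∈ins | ∈-map⁻ (outside ∷_) v∈outs
  ... | _ , _ , refl | _ , _ , ()

∈-allSubsets : (s : Subset k) → s ∈ₗ allSubsets k
∈-allSubsets []          = here refl
∈-allSubsets (true ∷ s)  = ∈-++⁺ˡ (∈-map⁺ (inside ∷_) (∈-allSubsets s))
∈-allSubsets (false ∷ s) = ∈-++⁺ʳ _ (∈-map⁺ (outside ∷_) (∈-allSubsets s))

length-filter-allSubsets≡2 : {P : Subset k → Set} (P? : Decidable P) {a b : Subset k} → a ≢ b →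
  P ≐ (λ t → t ≡ a ⊎ t ≡ b) → length (filter P? (allSubsets k)) ≡ 2
length-filter-allSubsets≡2 {k} P? {a} {b} a≢b P≐a∪b = begin
  length (filter P? (allSubsets k))
    ≡⟨ cong length (List.filter-≐ P? (λ t → (t ≟V a) ⊎-dec (t ≟V b)) P≐a∪b (allSubsets k)) ⟩
  length (filter (λ t → (t ≟V a) ⊎-dec (t ≟V b)) (allSubsets k))
    ≡⟨ length-filter-⊎ (_≟V a) (_≟V b) (λ { refl refl → a≢b refl }) (allSubsets k) ⟩
  length (filter (_≟V a) (allSubsets k)) + length (filter (_≟V b) (allSubsets k))
    ≡⟨ cong₂ _+_ (count a) (count b) ⟩
  2 ∎
  where
  open ≡-Reasoning
  count : (s : Subset k) → length (filter (_≟V s) (allSubsets k)) ≡ 1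
  count s = length-filter-≟ _≟V_ (allSubsets-unique k) (∈-allSubsets s)

module _ {C : Family 6 n} (cap : IsCap C) where

  cap6-relation≡⊤ : {T : Subset 6} → AffineRelation C T → T ≡ ⊤
  cap6-relation≡⊤ {T} rel = ∣p∣≡n⇒p≡⊤ (ℕ.≤-antisym (∣p∣≤n T) (cap-relation-size cap rel))

  cap6-dependent⇒sum≡𝟎 : AffinelyDependent C → sumSel C ⊤ ≡ 𝟎
  cap6-dependent⇒sum≡𝟎 (_ , rel) = subst (λ t → sumSel C t ≡ 𝟎) (cap6-relation≡⊤ rel) (AffineRelation.sum≡𝟎 rel)

  cap6-in-4-flat⇒sum≡𝟎 : (b : Family 5 n) → (∀ j → InAff b (C j)) → sumSel C ⊤ ≡ 𝟎
  cap6-in-4-flat⇒sum≡𝟎 b C⊆b = cap6-dependent⇒sum≡𝟎 (hull-dependent C b C⊆b)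

  sum≢𝟎⇒AffInd : sumSel C ⊤ ≢ 𝟎 → AffInd C
  sum≢𝟎⇒AffInd sum≢𝟎 i s i∉s odd-s e = sum≢𝟎 (cap6-dependent⇒sum≡𝟎 (_ , ¬AffInd⇒relation C i s i∉s odd-s e))

  AffInd-tail : AffInd (C ∘ suc)
  AffInd-tail i s i∉s odd-s e =
    contradiction (cap6-relation≡⊤ (relation-tail (¬AffInd⇒relation (C ∘ suc) i s i∉s odd-s e))) λ ()

  dim-4-or-5 : Dim C 4 ⊎ Dim C 5
  dim-4-or-5 with sumSel C ⊤ ≟V 𝟎
  ... | yes total = inj₁ (C ∘ suc , AffInd-tail , λ _ → InAff⇒InAff-tail C refl total , InAff-tail⇒InAff C)
  ... | no  total = inj₂ (C , sum≢𝟎⇒AffInd total , λ _ → id , id)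

  Dim4⇒sum≡𝟎 : Dim C 4 → sumSel C ⊤ ≡ 𝟎
  Dim4⇒sum≡𝟎 (b , _ , same-hull) = cap6-in-4-flat⇒sum≡𝟎 b (λ j → proj₁ (same-hull (C j)) (InAff-self C j))

  -- A relation among C forces the total sum to vanish, so aff C is spanned by five points of C,
  -- and the six-point basis of aff C would then be dependent.
  Dim5⇒AffInd : Dim C 5 → AffInd C
  Dim5⇒AffInd (b , b-ind , same-hull) i s i∉s odd-s e =
    AffInd⇒¬relation b-ind (proj₂ (hull-dependent b (C ∘ suc) b⊆tail))
    where
    total : sumSel C ⊤ ≡ 𝟎
    total = cap6-dependent⇒sum≡𝟎 (_ , ¬AffInd⇒relation C i s i∉s odd-s e)
    b⊆tail : ∀ j → InAff (C ∘ suc) (b j)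
    b⊆tail j = InAff⇒InAff-tail C refl total (proj₂ (same-hull (b j)) (InAff-self b j))

  small-representative : sumSel C ⊤ ≡ 𝟎 → (s : Subset 6) → OddSize s →
    ∃ λ s′ → ∣ s′ ∣ ≤ 3 × OddSize s′ × sumSel C s′ ≡ sumSel C s
  small-representative total s odd-s with ∣ s ∣ ≤? 3
  ... | yes ∣s∣≤3 = s , ∣s∣≤3 , odd-s , refl
  ... | no  ∣s∣≰3 = ∁ s , ∣∁s∣≤3 , ∁-represents C refl total s odd-s
    where
    ∣∁s∣≤3 : ∣ ∁ s ∣ ≤ 3
    ∣∁s∣≤3 = ℕ.≤-trans (ℕ.≤-reflexive (∣∁p∣≡n∸∣p∣ s)) (ℕ.∸-monoʳ-≤ 6 (ℕ.≰⇒≥ ∣s∣≰3))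

  -- A point x = Σ s′ of aff C outside C with |s′| ≤ 3 gives the relation {x} ∪ s′ of size ≤ 4 in x ∷ C.
  sum≡𝟎⇒complete : sumSel C ⊤ ≡ 𝟎 → CompleteInFlat C
  sum≡𝟎⇒complete total x (s , odd-s , e) x∉C nq
    with s′ , ∣s′∣≤3 , odd-s′ , e′ ← small-representative total s odd-s
    = contradiction (ℕ.≤-trans (cap-relation-size (∷-injective x∉C (proj₁ cap) , nq) relation) (s≤s ∣s′∣≤3))
        λ { (s≤s (s≤s (s≤s (s≤s ())))) }
    where
    relation : AffineRelation (x F.∷ C) (true ∷ s′)
    relation = affineRelation (zero , here) (trans (odd-suc ∣ s′ ∣) (cong not (OddSize⇒odd s′ odd-s′)))
      (≡⇒⊕≡𝟎 (sym (trans e′ e)))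

  -- Two triples with the same sum differ by an affine relation, which can only be all of C.
  triples-with-sum : sumSel C ⊤ ≡ 𝟎 → {x : V n} {s : Subset 6} → ∣ s ∣ ≡ 3 → sumSel C s ≡ x →
    (λ t → ∣ t ∣ ≡ 3 × sumSel C t ≡ x) ≐ (λ t → t ≡ s ⊎ t ≡ ∁ s)
  triples-with-sum total {x} {s} ∣s∣≡3 e = same-sum⇒s-or-∁s , s-or-∁s⇒same-sum
    where
    odd-3 : (t : Subset 6) → ∣ t ∣ ≡ 3 → odd ∣ t ∣ ≡ true
    odd-3 _ ∣t∣≡3 = cong odd ∣t∣≡3
    same-sum⇒s-or-∁s : {t : Subset 6} → ∣ t ∣ ≡ 3 × sumSel C t ≡ x → t ≡ s ⊎ t ≡ ∁ s
    same-sum⇒s-or-∁s {t} (∣t∣≡3 , e′) with (t ⊕ s) ≟V 𝟎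
    ... | yes t⊕s≡𝟎 = inj₁ (⊕≡𝟎⇒≡ t⊕s≡𝟎)
    ... | no  t⊕s≢𝟎 = inj₂ (⊕≡𝟎⇒≡ (begin
      t ⊕ ∁ s        ≡⟨ cong (t ⊕_) (⊕⊤≡∁ s) ⟨
      t ⊕ (s ⊕ ⊤)    ≡⟨ ⊕-assoc t s ⊤ ⟨
      (t ⊕ s) ⊕ ⊤    ≡⟨ cong (_⊕ ⊤) t⊕s≡⊤ ⟩
      ⊤ ⊕ ⊤          ≡⟨ ⊕-self ⊤ ⟩
      𝟎              ∎))
      where
      open ≡-Reasoning
      t⊕s≡⊤ : t ⊕ s ≡ ⊤
      t⊕s≡⊤ = cap6-relation≡⊤ (affineRelation (≢𝟎⇒Nonempty t⊕s≢𝟎)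
        (trans (odd-∣⊕∣ t s) (cong₂ _xor_ (odd-3 t ∣t∣≡3) (odd-3 s ∣s∣≡3)))
        (trans (sumSel-⊕ C t s) (≡⇒⊕≡𝟎 (trans e′ (sym e)))))
    s-or-∁s⇒same-sum : {t : Subset 6} → t ≡ s ⊎ t ≡ ∁ s → ∣ t ∣ ≡ 3 × sumSel C t ≡ x
    s-or-∁s⇒same-sum (inj₁ refl) = ∣s∣≡3 , e
    s-or-∁s⇒same-sum (inj₂ refl) =
      trans (∣∁p∣≡n∸∣p∣ s) (cong (6 ∸_) ∣s∣≡3) ,
      trans (proj₂ (∁-represents C refl total s (odd⇒OddSize s (odd-3 s ∣s∣≡3)))) e

  sum≡𝟎⇒multiplicity≡2 : sumSel C ⊤ ≡ 𝟎 → ∀ x → InExc C x → multiplicity C x ≡ 2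
  sum≡𝟎⇒multiplicity≡2 total x (s , ∣s∣≡3 , e) =
    length-filter-allSubsets≡2 (λ t → (∣ t ∣ ℕ.≟ 3) ×-dec (sumSel C t ≟V x)) (≢∁ s) (triples-with-sum total ∣s∣≡3 e)

-- Dropping f₀ or f₁ leaves two 6-caps in the flat; both their sums f₁ ⊕ r and f₀ ⊕ r,
-- where r = f₂ ⊕ ⋯ ⊕ f₆, vanish.
no-7-cap-in-4-flat : (f : Family 7 n) → IsCap f → (b : Family 5 n) → (∀ j → InAff b (f j)) → ⊥
no-7-cap-in-4-flat f cap b f⊆b = contradiction (proj₁ cap f₀≡f₁) λ ()
  where
  drop₀ : sumSel (f ∘ suc) ⊤ ≡ 𝟎
  drop₀ = cap6-in-4-flat⇒sum≡𝟎 (IsCap-∘ cap suc Fin.suc-injective) b (f⊆b ∘ suc)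
  drop₁ : sumSel (f ∘ punchIn (suc zero)) ⊤ ≡ 𝟎
  drop₁ = cap6-in-4-flat⇒sum≡𝟎 (IsCap-∘ cap (punchIn (suc zero)) (Fin.punchIn-injective (suc zero) _ _))
    b (f⊆b ∘ punchIn (suc zero))
  f₀≡f₁ : f zero ≡ f (suc zero)
  f₀≡f₁ = trans (⊕≡𝟎⇒≡ drop₁) (sym (⊕≡𝟎⇒≡ drop₀))

cap-in-4-flat-size≤6 : {D : Family m n} → IsCap D → InFlat 4 D → m ≤ 6
cap-in-4-flat-size≤6 {m} {D = D} cap (b , _ , D⊆b) with m ≤? 6
... | yes m≤6 = m≤6
... | no  m≰6 = ⊥-elim (no-7-cap-in-4-flat (D ∘ σ) (IsCap-∘ cap σ (Fin.inject≤-injective 7≤m 7≤m _ _)) b (D⊆b ∘ σ))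
  where
  7≤m : 7 ≤ m
  7≤m = ℕ.≰⇒> m≰6
  σ : Fin 7 → Fin m
  σ i = inject≤ i 7≤m

theorem5p16 : ∀ (n : ℕ) (C : Family 6 n) → IsCap C →
    (Dim C 4 ⊎ Dim C 5)
    × (Dim C 5 → AffInd C)
    × (Dim C 4 →
        CompleteInFlat C
        × MaximalCap 4 C
        × (∀ p → InExc C p → multiplicity C p ≡ 2))
theorem5p16 n C cap = dim-4-or-5 cap , Dim5⇒AffInd cap , dim-4
  where
  dim-4 : Dim C 4 → CompleteInFlat C × MaximalCap 4 C × (∀ p → InExc C p → multiplicity C p ≡ 2)
  dim-4 dim = complete , (complete , λ _ _ D-cap → cap-in-4-flat-size≤6 D-cap) , sum≡𝟎⇒multiplicity≡2 cap total
    where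
    total : sumSel C ⊤ ≡ 𝟎
    total = Dim4⇒sum≡𝟎 cap dim
    complete : CompleteInFlat C
    complete = sum≡𝟎⇒complete cap total
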